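{- Let $x$ be a positive integer. Consider the process that starts with $x_0=x$ and, as long as $x_i>4$, computes $x_{i+1}=\lfloor x_i(1/2+1/\sqrt{x_i})\rfloor$. The process ends after at most $\log x+\mathcal{O}(\log^* x)$ steps.
   Context: Logarithms are base 2; $\log^*$ is the iterated logarithm. -}

module Defs where

open import Data.Nat using (ℕ; zero; suc; _+_; _*_; _∸_; _^_; _≤_; _<_; _≤ᵇ_)
open import Data.Bool using (if_then_else_)
open import Data.Sum using (_⊎_)
open import Data.Product using (_×_)
open import Relation.Nullary using (¬_)

-- For a real-valued comparison with x/2 + √x, expressed exactly in ℕ:
--   b ≤ a/2 + √a  ⇔  2b - a ≤ 2√a  ⇔  2b ≤ a  or  (2b - a)² ≤ 4a.
LeHalfPlusSqrt : ℕ → ℕ → Set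
LeHalfPlusSqrt a b = (2 * b ≤ a) ⊎ ((2 * b ∸ a) ^ 2 ≤ 4 * a)

-- b ≡ ⌊ a (1/2 + 1/√a) ⌋ = ⌊ a/2 + √a ⌋, i.e. b ≤ a/2 + √a < b + 1.
IsFloorStep : ℕ → ℕ → Set
IsFloorStep a b = LeHalfPlusSqrt a b × ¬ LeHalfPlusSqrt a (suc b)

tower : ℕ → ℕ
tower zero = 1
tower (suc k) = 2 ^ tower k

-- log* x = number of times log₂ must be applied (to the real number x)
-- until the result is ≤ 1; equivalently the least k with x ≤ tower k.
-- Search with fuel: since k < tower k, the least such k is ≤ x.
logStarFrom : ℕ → ℕ → ℕ → ℕ
logStarFrom x zero k = k
logStarFrom x (suc fuel) k = if x ≤ᵇ tower k then k else logStarFrom x fuel (suc k)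

log* : ℕ → ℕ
log* x = logStarFrom x x 0

module Submission where

-- With s = √x, one step maps s to about s/√2 + O(1), so two steps halve √x up to an
-- additive constant: exactly, x ≤ (4R+3)² forces x₂ ≤ (2R+3)² once R ≥ 17. Starting
-- below (2^(k+7) + 3)² with 2k ≤ ⌊log₂ x⌋, after 2k steps the value is at most 131²,
-- and as every step strictly decreases a value above 4, at most 131² steps remain.
-- So the process stops after ⌊log₂ x⌋ + O(1) steps, and the constant is absorbed
-- by C · log* x because log* x ≥ 1 for x ≥ 2.

open import Defs
open import Data.Nat using (ℕ; >-nonZero; zero; suc; _+_; _*_; _∸_; _^_; _≤_; _<_; _≤ᵇ_; z≤n; s≤s; ⌊_/2⌋)
open import Data.Nat.Properties
open import Data.Nat.Logarithm using (⌊log₂_⌋; ⌊log₂⌋-mono-≤; ⌊log₂[2^n]⌋≡n)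
open import Data.Nat.Tactic.RingSolver using (solve-∀)
open import Data.Bool using (true; false)
open import Data.Product using (∃-syntax; _,_; proj₁)
open import Data.Sum using (inj₁; inj₂)
open import Relation.Nullary using (¬_)
open import Relation.Binary.PropositionalEquality using (_≡_; sym; cong; subst)
open ≤-Reasoning

m^2≡m*m : ∀ m → m ^ 2 ≡ m * m
m^2≡m*m m = cong (m *_) (*-identityʳ m)

m*m≤n*n⇒m≤n : ∀ {m n} → m * m ≤ n * n → m ≤ n
m*m≤n*n⇒m≤n m*m≤n*n = ≮⇒≥ (λ n<m → <⇒≱ (*-mono-< n<m n<m) m*m≤n*n)

LeHalfPlusSqrt-bound : ∀ {a b} s → a ≤ s * s → LeHalfPlusSqrt a b → 2 * b ≤ a + 2 * s
LeHalfPlusSqrt-bound {a} {b} s a≤s² (inj₁ 2b≤a) = ≤-trans 2b≤a (m≤m+n a (2 * s))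
LeHalfPlusSqrt-bound {a} {b} s a≤s² (inj₂ d²≤4a) = begin
  2 * b            ≤⟨ m≤n+m∸n (2 * b) a ⟩
  a + (2 * b ∸ a)  ≤⟨ +-monoʳ-≤ a (m*m≤n*n⇒m≤n d²≤[2s]²) ⟩
  a + 2 * s        ∎
  where
  4t²≡[2t]² : ∀ t → 4 * (t * t) ≡ (2 * t) * (2 * t)
  4t²≡[2t]² = solve-∀
  d : ℕ
  d = 2 * b ∸ a
  d²≤[2s]² : d * d ≤ (2 * s) * (2 * s)
  d²≤[2s]² = begin
    d * d            ≡⟨ sym (m^2≡m*m d) ⟩
    d ^ 2            ≤⟨ d²≤4a ⟩
    4 * a            ≤⟨ *-monoʳ-≤ 4 a≤s² ⟩
    4 * (s * s)      ≡⟨ 4t²≡[2t]² s ⟩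
    (2 * s) * (2 * s) ∎

m≤n⇒m≤2*n∸m : ∀ {m n} → m ≤ n → m ≤ 2 * n ∸ m
m≤n⇒m≤2*n∸m {m} {n} m≤n = begin
  m          ≡⟨ sym (m+n∸n≡m m m) ⟩
  m + m ∸ m  ≡⟨ cong (_∸ m) (sym (2*m≡m+m m)) ⟩
  2 * m ∸ m  ≤⟨ ∸-monoˡ-≤ m (*-monoʳ-≤ 2 m≤n) ⟩
  2 * n ∸ m  ∎
  where
  2*m≡m+m : ∀ m → 2 * m ≡ m + m
  2*m≡m+m = solve-∀

LeHalfPlusSqrt-< : ∀ {a b} → 4 < a → LeHalfPlusSqrt a b → b < a
LeHalfPlusSqrt-< {a} {b} 4<a le = ≰⇒> (a≰b le)
  where
  0<a : 0 < a
  0<a = ≤-trans (s≤s z≤n) 4<a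
  a≰b : LeHalfPlusSqrt a b → ¬ a ≤ b
  a≰b (inj₁ 2b≤a) a≤b = <⇒≱ 0<a (subst (a ≤_) (m≤n⇒m∸n≡0 2b≤a) (m≤n⇒m≤2*n∸m a≤b))
  a≰b (inj₂ d²≤4a) a≤b = <⇒≱ 4<a (*-cancelʳ-≤ a 4 a {{>-nonZero 0<a}} (begin
    a * a  ≤⟨ *-mono-≤ a≤d a≤d ⟩
    d * d  ≡⟨ sym (m^2≡m*m d) ⟩
    d ^ 2  ≤⟨ d²≤4a ⟩
    4 * a  ∎))
    where
    d : ℕ
    d = 2 * b ∸ a
    a≤d : a ≤ d
    a≤d = m≤n⇒m≤2*n∸m a≤b

IsRun : (ℕ → ℕ) → Set
IsRun seq = ∀ i → 4 < seq i → LeHalfPlusSqrt (seq i) (seq (suc i))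

LastsFor : (ℕ → ℕ) → ℕ → Set
LastsFor seq n = ∀ j → j < n → 4 < seq j

tail : (ℕ → ℕ) → (ℕ → ℕ)
tail seq i = seq (suc i)

IsRun-tail : ∀ {seq} → IsRun seq → IsRun (tail seq)
IsRun-tail run i = run (suc i)

LastsFor-tail : ∀ {seq n} → LastsFor seq (suc n) → LastsFor (tail seq) n
LastsFor-tail lasts j j<n = lasts (suc j) (s≤s j<n)

LastsFor-≤-start : ∀ {seq} n → IsRun seq → LastsFor seq n → n ≤ seq 0
LastsFor-≤-start zero    run lasts = z≤n
LastsFor-≤-start {seq} (suc n) run lasts =
  ≤-trans (s≤s (LastsFor-≤-start n (IsRun-tail run) (LastsFor-tail lasts)))
          (LeHalfPlusSqrt-< 4<seq₀ (run 0 4<seq₀))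
  where
  4<seq₀ : 4 < seq 0
  4<seq₀ = lasts 0 (s≤s z≤n)

level : ℕ → ℕ
level R = 2 * R + 3

32*R+15≤2*R*R : ∀ {R} → 17 ≤ R → 32 * R + 15 ≤ 2 * (R * R)
32*R+15≤2*R*R {R} 17≤R = begin
  32 * R + 15      ≤⟨ +-monoʳ-≤ (32 * R) (≤-trans (m≤m+n 15 19) (*-monoʳ-≤ 2 17≤R)) ⟩
  32 * R + 2 * R   ≡⟨ 32t+2t≡2*[17*t] R ⟩
  2 * (17 * R)     ≤⟨ *-monoʳ-≤ 2 (*-monoˡ-≤ R 17≤R) ⟩
  2 * (R * R)      ∎
  where
  32t+2t≡2*[17*t] : ∀ t → 32 * t + 2 * t ≡ 2 * (17 * t)
  32t+2t≡2*[17*t] = solve-∀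

twoSteps-contract : ∀ {R a b c} → 17 ≤ R → a ≤ level (2 * R) * level (2 * R) →
                    LeHalfPlusSqrt a b → LeHalfPlusSqrt b c → c ≤ level R * level R
twoSteps-contract {R} {a} {b} {c} 17≤R a≤ ab bc = *-cancelˡ-≤ 4 (begin
  4 * c                      ≡⟨ 4t≡2*[2*t] c ⟩
  2 * (2 * c)                ≤⟨ *-monoʳ-≤ 2 (LeHalfPlusSqrt-bound {b = c} (3 * R) b≤[3R]² bc) ⟩
  2 * (b + 2 * (3 * R))      ≡⟨ 2*[t+2*[3*u]]≡2t+12u b R ⟩
  2 * b + 12 * R             ≤⟨ +-monoˡ-≤ (12 * R) 2b≤B ⟩
  B + 12 * R                 ≤⟨ m≤m+n (B + 12 * R) (4 * R + 21) ⟩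
  B + 12 * R + (4 * R + 21)  ≡⟨ B+12R+[4R+21]≡4*level² R ⟩
  4 * (level R * level R)    ∎)
  where
  B : ℕ
  B = 16 * (R * R) + 32 * R + 15
  s : ℕ
  s = level (2 * R)
  level²+2level≡B : ∀ t → (2 * (2 * t) + 3) * (2 * (2 * t) + 3) + 2 * (2 * (2 * t) + 3) ≡ 16 * (t * t) + 32 * t + 15
  level²+2level≡B = solve-∀
  16t²+2t²≡2*[3t]² : ∀ t → 16 * (t * t) + 2 * (t * t) ≡ 2 * ((3 * t) * (3 * t))
  16t²+2t²≡2*[3t]² = solve-∀
  4t≡2*[2*t] : ∀ t → 4 * t ≡ 2 * (2 * t)
  4t≡2*[2*t] = solve-∀
  2*[t+2*[3*u]]≡2t+12u : ∀ t u → 2 * (t + 2 * (3 * u)) ≡ 2 * t + 12 * u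
  2*[t+2*[3*u]]≡2t+12u = solve-∀
  B+12R+[4R+21]≡4*level² : ∀ t → 16 * (t * t) + 32 * t + 15 + 12 * t + (4 * t + 21) ≡ 4 * ((2 * t + 3) * (2 * t + 3))
  B+12R+[4R+21]≡4*level² = solve-∀
  2b≤B : 2 * b ≤ B
  2b≤B = begin
    2 * b          ≤⟨ LeHalfPlusSqrt-bound {b = b} s a≤ ab ⟩
    a + 2 * s      ≤⟨ +-monoˡ-≤ (2 * s) a≤ ⟩
    s * s + 2 * s  ≡⟨ level²+2level≡B R ⟩
    B              ∎
  b≤[3R]² : b ≤ (3 * R) * (3 * R)
  b≤[3R]² = *-cancelˡ-≤ 2 (begin
    2 * b                          ≤⟨ 2b≤B ⟩
    16 * (R * R) + 32 * R + 15     ≡⟨ +-assoc (16 * (R * R)) (32 * R) 15 ⟩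
    16 * (R * R) + (32 * R + 15)   ≤⟨ +-monoʳ-≤ (16 * (R * R)) (32*R+15≤2*R*R 17≤R) ⟩
    16 * (R * R) + 2 * (R * R)     ≡⟨ 16t²+2t²≡2*[3t]² R ⟩
    2 * ((3 * R) * (3 * R))        ∎)

LastsFor-≤-ladder : ∀ k {seq n} → IsRun seq →
                    seq 0 ≤ level (2 ^ k * 64) * level (2 ^ k * 64) → LastsFor seq n →
                    n ≤ 2 * k + level 64 * level 64
LastsFor-≤-ladder zero    {n = n} run seq₀≤ lasts = ≤-trans (LastsFor-≤-start n run lasts) seq₀≤
LastsFor-≤-ladder (suc k) {n = zero}  run seq₀≤ lasts = z≤n
LastsFor-≤-ladder (suc k) {n = suc zero} run seq₀≤ lasts = ≤-trans (s≤s z≤n) (m≤n+m _ (2 * suc k))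
LastsFor-≤-ladder (suc k) {seq} {suc (suc n)} run seq₀≤ lasts =
  subst (suc (suc n) ≤_) (sym (cong (_+ level 64 * level 64) (*-suc 2 k))) (s≤s (s≤s ih))
  where
  R : ℕ
  R = 2 ^ k * 64
  17≤R : 17 ≤ R
  17≤R = ≤-trans (m≤m+n 17 47) (*-monoˡ-≤ 64 (m^n>0 2 k))
  4<seq₀ : 4 < seq 0
  4<seq₀ = lasts 0 (s≤s z≤n)
  4<seq₁ : 4 < seq 1
  4<seq₁ = lasts 1 (s≤s (s≤s z≤n))
  seq₂≤ : seq 2 ≤ level R * level R
  seq₂≤ = twoSteps-contract 17≤R
            (subst (λ t → seq 0 ≤ level t * level t) (*-assoc 2 (2 ^ k) 64) seq₀≤)
            (run 0 4<seq₀) (run 1 4<seq₁)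
  ih : n ≤ 2 * k + level 64 * level 64
  ih = LastsFor-≤-ladder k (IsRun-tail (IsRun-tail run)) seq₂≤ (LastsFor-tail (LastsFor-tail lasts))

n<2^[1+⌊log₂n⌋] : ∀ n → n < 2 ^ suc ⌊log₂ n ⌋
n<2^[1+⌊log₂n⌋] n = ≰⇒> (λ 2^[1+L]≤n → <⇒≱ ≤-refl
  (subst (_≤ ⌊log₂ n ⌋) (⌊log₂[2^n]⌋≡n (suc ⌊log₂ n ⌋)) (⌊log₂⌋-mono-≤ 2^[1+L]≤n)))

2*⌊n/2⌋≤n : ∀ n → 2 * ⌊ n /2⌋ ≤ n
2*⌊n/2⌋≤n zero          = z≤n
2*⌊n/2⌋≤n (suc zero)    = z≤n
2*⌊n/2⌋≤n (suc (suc n)) = subst (_≤ suc (suc n)) (sym (*-suc 2 ⌊ n /2⌋)) (s≤s (s≤s (2*⌊n/2⌋≤n n)))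

n≤1+2*⌊n/2⌋ : ∀ n → n ≤ suc (2 * ⌊ n /2⌋)
n≤1+2*⌊n/2⌋ zero          = z≤n
n≤1+2*⌊n/2⌋ (suc zero)    = ≤-refl
n≤1+2*⌊n/2⌋ (suc (suc n)) = subst (λ m → suc (suc n) ≤ suc m) (sym (*-suc 2 ⌊ n /2⌋)) (s≤s (s≤s (n≤1+2*⌊n/2⌋ n)))

2^[2+2*k]≤level² : ∀ k → 2 ^ (2 + 2 * k) ≤ level (2 ^ k * 64) * level (2 ^ k * 64)
2^[2+2*k]≤level² k = begin
  2 ^ (2 + 2 * k)              ≡⟨ ^-distribˡ-+-* 2 2 (2 * k) ⟩
  4 * 2 ^ (2 * k)              ≡⟨ cong (λ m → 4 * 2 ^ (k + m)) (+-identityʳ k) ⟩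
  4 * 2 ^ (k + k)              ≡⟨ cong (4 *_) (^-distribˡ-+-* 2 k k) ⟩
  4 * (t * t)                  ≤⟨ m≤m+n (4 * (t * t)) _ ⟩
  4 * (t * t) + (16380 * (t * t) + 768 * t + 9)  ≡⟨ 4t²+…≡level[t*64]² t ⟩
  level (t * 64) * level (t * 64) ∎
  where
  t : ℕ
  t = 2 ^ k
  4t²+…≡level[t*64]² : ∀ t → 4 * (t * t) + (16380 * (t * t) + 768 * t + 9) ≡ (2 * (t * 64) + 3) * (2 * (t * 64) + 3)
  4t²+…≡level[t*64]² = solve-∀

k≤logStarFrom : ∀ x fuel k → k ≤ logStarFrom x fuel k
k≤logStarFrom x zero       k = ≤-refl
k≤logStarFrom x (suc fuel) k with x ≤ᵇ tower k
... | true  = ≤-refl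
... | false = ≤-trans (n≤1+n k) (k≤logStarFrom x fuel (suc k))

1≤log*[2+n] : ∀ n → 1 ≤ log* (suc (suc n))
1≤log*[2+n] n = k≤logStarFrom (suc (suc n)) (suc n) 1

lemma2p8 : ∃[ C ] ∃[ N ] ∀ (x : ℕ) → 1 ≤ x → N ≤ x →
    ∀ (seq : ℕ → ℕ) → seq 0 ≡ x →
    (∀ i → 4 < seq i → IsFloorStep (seq i) (seq (suc i))) →
    ∀ (n : ℕ) → (∀ j → j < n → 4 < seq j) →
    n ≤ ⌊log₂ x ⌋ + C * log* x
lemma2p8 = K , 2 , bound
  where
  K : ℕ
  K = level 64 * level 64
  bound : ∀ (x : ℕ) → 1 ≤ x → 2 ≤ x → ∀ (seq : ℕ → ℕ) → seq 0 ≡ x →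
          (∀ i → 4 < seq i → IsFloorStep (seq i) (seq (suc i))) →
          ∀ n → LastsFor seq n → n ≤ ⌊log₂ x ⌋ + K * log* x
  bound (suc zero) _ (s≤s ()) _ _ _ _ _
  bound x@(suc (suc m)) _ _ seq seq₀≡x steps n lasts = begin
    n               ≤⟨ LastsFor-≤-ladder k (λ i 4<seqᵢ → proj₁ (steps i 4<seqᵢ)) seq₀≤ lasts ⟩
    2 * k + K       ≤⟨ +-mono-≤ (2*⌊n/2⌋≤n L) (m≤m*n K (log* x) {{>-nonZero (1≤log*[2+n] m)}}) ⟩
    L + K * log* x  ∎
    where
    L k : ℕ
    L = ⌊log₂ x ⌋
    k = ⌊ L /2⌋
    seq₀≤ : seq 0 ≤ level (2 ^ k * 64) * level (2 ^ k * 64)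
    seq₀≤ = begin
      seq 0            ≡⟨ seq₀≡x ⟩
      x                ≤⟨ <⇒≤ (n<2^[1+⌊log₂n⌋] x) ⟩
      2 ^ suc L        ≤⟨ ^-monoʳ-≤ 2 (s≤s (n≤1+2*⌊n/2⌋ L)) ⟩
      2 ^ (2 + 2 * k)  ≤⟨ 2^[2+2*k]≤level² k ⟩
      level (2 ^ k * 64) * level (2 ^ k * 64) ∎
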